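{- Let $k\geq 1$ be an integer and write $f_{2^k,n}:=f_{2^k,n}(-1)=\sum_{j=0}^{n}\binom{n}{j}(-1)^{\binom{j}{2^k}}$. Then, as formal power series (and as rational functions), \[\sum_{n=0}^{\infty}f_{2^k,n}x^n=\frac{1}{x^{2^k}+(x-1)^{2^k}}\prod_{j=1}^{k-1}\left(x^{2^j}+(x-1)^{2^j}\right),\] or equivalently \[\sum_{n=0}^{\infty}f_{2^k,n}x^n=\frac{1}{2x-1}\cdot\frac{x^{2^k}-(x-1)^{2^k}}{x^{2^k}+(x-1)^{2^k}}.\]
   Context: Here $\binom{j}{m}=0$ for $0\le j<m$; $f_{m,n}(z)=\sum_{j=0}^{n}\binom{n}{j}z^{\binom{j}{m}}$. -}

module Defs where

open import Data.Nat using (ℕ; zero; suc; _∸_) renaming (_+_ to _+ℕ_; _^_ to _^ℕ_)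
open import Data.Nat.Combinatorics using (_C_)
open import Data.Integer using (ℤ; +_; -_; _+_; _*_; _-_; _^_)
open import Data.List using (List; []; _∷_)

sumTo : ℕ → (ℕ → ℤ) → ℤ
sumTo zero    g = g zero
sumTo (suc n) g = sumTo n g + g (suc n)

f : ℕ → ℕ → ℤ
f m n = sumTo n (λ j → (+ (n C j)) * ((- (+ 1)) ^ (j C m)))

-- Polynomials over ℤ as coefficient lists, lowest degree first.
Poly : Set
Poly = List ℤ

coeff : Poly → ℕ → ℤ
coeff []       _       = + 0
coeff (a ∷ p)  zero    = a
coeff (a ∷ p)  (suc i) = coeff p i

_⊕_ : Poly → Poly → Poly
[]      ⊕ q       = q
(a ∷ p) ⊕ []      = a ∷ p
(a ∷ p) ⊕ (b ∷ q) = (a + b) ∷ (p ⊕ q)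

scale : ℤ → Poly → Poly
scale c []      = []
scale c (a ∷ p) = (c * a) ∷ scale c p

_⊗_ : Poly → Poly → Poly
[]      ⊗ q = []
(a ∷ p) ⊗ q = scale a q ⊕ (+ 0 ∷ (p ⊗ q))

neg : Poly → Poly
neg = scale (- (+ 1))

_⊖_ : Poly → Poly → Poly
p ⊖ q = p ⊕ neg q

one : Poly
one = + 1 ∷ []

X : Poly
X = + 0 ∷ + 1 ∷ []

X-1 : Poly
X-1 = - (+ 1) ∷ + 1 ∷ []

2X-1 : Poly
2X-1 = - (+ 1) ∷ + 2 ∷ []

_⊗^_ : Poly → ℕ → Poly
p ⊗^ zero  = one
p ⊗^ suc n = p ⊗ (p ⊗^ n)

plusTerm : ℕ → Poly
plusTerm j = (X ⊗^ (2 ^ℕ j)) ⊕ (X-1 ⊗^ (2 ^ℕ j))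

minusTerm : ℕ → Poly
minusTerm j = (X ⊗^ (2 ^ℕ j)) ⊖ (X-1 ⊗^ (2 ^ℕ j))

prodFrom1Below : ℕ → Poly
prodFrom1Below zero    = one
prodFrom1Below (suc zero) = one
prodFrom1Below (suc (suc k)) = prodFrom1Below (suc k) ⊗ plusTerm (suc k)

mulSeries : Poly → (ℕ → ℤ) → ℕ → ℤ
mulSeries p a n = sumTo n (λ i → coeff p i * a (n ∸ i))

{-# OPTIONS --safe #-}
-- Write G_s for the generating function of the binomial transform of s, so that the series in
-- question is G_s with s_j = (-1)^C(j,m), m = 2ᵏ. Since G_s(x) = S(x/(1-x))/(1-x), peeling off
-- the first m terms of s, which are all 1, gives (2x-1)((x-1)ᵐ G_s - (-x)ᵐ G_{drop m s}) =
-- (-x)ᵐ - (x-1)ᵐ. As (1+x)ᵐ ≡ 1 + xᵐ (mod 2), s is antiperiodic with period m, so for even m this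
-- reads (2x-1)(xᵐ + (x-1)ᵐ) G_s = xᵐ - (x-1)ᵐ. The product form follows because the factors
-- x^{2ʲ} + (x-1)^{2ʲ} telescope (A + B)(A - B) = A² - B² down to x² - (x-1)² = 2x - 1, which may
-- be cancelled since its constant term is a unit.
module Submission where

open import Defs
open import Data.Nat using (ℕ; zero; suc; _≥_; _^_; _<_; _∸_; s≤s; z≤n) renaming (_+_ to _+ℕ_)
open import Data.Nat.Combinatorics using (_C_; nCk+nC[k+1]≡[n+1]C[k+1]; k>n⇒nCk≡0)
import Data.Nat.Properties as ℕₚ
open import Data.Integer using (ℤ; +_; -_; _+_; _*_; _-_) renaming (_^_ to _^ℤ_)
import Data.Integer.Properties as ℤₚ
open import Algebra.Properties.AbelianGroup ℤₚ.+-0-abelianGroup using (∙-cancelˡ)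
open import Data.Integer.Tactic.RingSolver using (solve-∀)
open import Data.List using ([]; _∷_)
open import Data.Product using (_×_; _,_)
open import Relation.Nullary using (yes; no)
open import Relation.Binary.PropositionalEquality
open ≡-Reasoning

sumTo-cong : ∀ n {g h : ℕ → ℤ} → g ≗ h → sumTo n g ≡ sumTo n h
sumTo-cong zero    g≗h = g≗h 0
sumTo-cong (suc n) g≗h = cong₂ _+_ (sumTo-cong n g≗h) (g≗h (suc n))

sumTo-zero : ∀ n {g : ℕ → ℤ} → (∀ i → g i ≡ + 0) → sumTo n g ≡ + 0
sumTo-zero zero    g≡0 = g≡0 0
sumTo-zero (suc n) g≡0 = cong₂ _+_ (sumTo-zero n g≡0) (g≡0 (suc n))

sumTo-+ : ∀ n (g h : ℕ → ℤ) → sumTo n (λ i → g i + h i) ≡ sumTo n g + sumTo n h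
sumTo-+ zero    g h = refl
sumTo-+ (suc n) g h = trans (cong (_+ (g (suc n) + h (suc n))) (sumTo-+ n g h))
                            (swap (sumTo n g) (sumTo n h) (g (suc n)) (h (suc n)))
  where swap : ∀ a b c d → (a + b) + (c + d) ≡ (a + c) + (b + d)
        swap = solve-∀

sumTo-neg : ∀ n (g : ℕ → ℤ) → sumTo n (λ i → - g i) ≡ - sumTo n g
sumTo-neg zero    g = refl
sumTo-neg (suc n) g =
  trans (cong (_+ (- g (suc n))) (sumTo-neg n g)) (sym (ℤₚ.neg-distrib-+ (sumTo n g) (g (suc n))))

sumTo-suc : ∀ n g → sumTo (suc n) g ≡ g 0 + sumTo n (λ i → g (suc i))
sumTo-suc zero    g = refl
sumTo-suc (suc n) g =
  trans (cong (_+ g (suc (suc n))) (sumTo-suc n g)) (ℤₚ.+-assoc (g 0) _ _)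

Series : Set
Series = ℕ → ℤ

shift : Series → Series
shift a zero    = + 0
shift a (suc n) = a n

δ : Series
δ zero    = + 1
δ (suc n) = + 0

drop : ℕ → Series → Series
drop i s j = s (i +ℕ j)

-- p ⋆ a is the coefficient sequence of p(x) · Σ aₙ xⁿ, by Horner's rule on p.
_⋆_ : Poly → Series → Series
([]      ⋆ a) n = + 0
((c ∷ p) ⋆ a) n = c * a n + shift (p ⋆ a) n

mulSeries≗⋆ : ∀ p a → mulSeries p a ≗ p ⋆ a
mulSeries≗⋆ []      a n       = sumTo-zero n (λ i → ℤₚ.*-zeroˡ (a (n ∸ i)))
mulSeries≗⋆ (c ∷ p) a zero    = sym (ℤₚ.+-identityʳ (c * a 0))
mulSeries≗⋆ (c ∷ p) a (suc n) =
  trans (sumTo-suc n _) (cong (_+_ (c * a (suc n))) (mulSeries≗⋆ p a n))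

shift-cong : ∀ {a b} → a ≗ b → shift a ≗ shift b
shift-cong a≗b zero    = refl
shift-cong a≗b (suc n) = a≗b n

⋆-cong : ∀ p {a b} → a ≗ b → p ⋆ a ≗ p ⋆ b
⋆-cong []      a≗b n = refl
⋆-cong (c ∷ p) a≗b n = cong₂ (λ x y → c * x + y) (a≗b n) (shift-cong (⋆-cong p a≗b) n)

⋆-zero : ∀ p {a} → (∀ m → a m ≡ + 0) → ∀ n → (p ⋆ a) n ≡ + 0
⋆-zero []      a≡0 n       = refl
⋆-zero (c ∷ p) a≡0 zero    = trans (cong (λ x → c * x + + 0) (a≡0 0)) (cong (_+ + 0) (ℤₚ.*-zeroʳ c))
⋆-zero (c ∷ p) a≡0 (suc n) =
  trans (cong₂ (λ x y → c * x + y) (a≡0 (suc n)) (⋆-zero p a≡0 n)) (cong (_+ + 0) (ℤₚ.*-zeroʳ c))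

shift-+ : ∀ a b n → shift (λ m → a m + b m) n ≡ shift a n + shift b n
shift-+ a b zero    = refl
shift-+ a b (suc n) = refl

shift-sub : ∀ a b n → shift (λ m → a m - b m) n ≡ shift a n - shift b n
shift-sub a b zero    = refl
shift-sub a b (suc n) = refl

shift-*ˡ : ∀ c a n → shift (λ m → c * a m) n ≡ c * shift a n
shift-*ˡ c a zero    = sym (ℤₚ.*-zeroʳ c)
shift-*ˡ c a (suc n) = refl

⋆-+ : ∀ p a b n → (p ⋆ (λ m → a m + b m)) n ≡ (p ⋆ a) n + (p ⋆ b) n
⋆-+ []      a b n = refl
⋆-+ (c ∷ p) a b n = begin
  c * (a n + b n) + shift (p ⋆ (λ m → a m + b m)) n
    ≡⟨ cong (_+_ (c * (a n + b n))) (trans (shift-cong (⋆-+ p a b) n) (shift-+ (p ⋆ a) (p ⋆ b) n)) ⟩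
  c * (a n + b n) + (shift (p ⋆ a) n + shift (p ⋆ b) n)
    ≡⟨ distrib c (a n) (b n) (shift (p ⋆ a) n) (shift (p ⋆ b) n) ⟩
  (c * a n + shift (p ⋆ a) n) + (c * b n + shift (p ⋆ b) n) ∎
  where distrib : ∀ c x y u v → c * (x + y) + (u + v) ≡ (c * x + u) + (c * y + v)
        distrib = solve-∀

⋆-*ˡ : ∀ p c a n → (p ⋆ (λ m → c * a m)) n ≡ c * (p ⋆ a) n
⋆-*ˡ []      c a n = sym (ℤₚ.*-zeroʳ c)
⋆-*ˡ (d ∷ p) c a n = begin
  d * (c * a n) + shift (p ⋆ (λ m → c * a m)) n
    ≡⟨ cong (_+_ (d * (c * a n))) (trans (shift-cong (⋆-*ˡ p c a) n) (shift-*ˡ c (p ⋆ a) n)) ⟩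
  d * (c * a n) + c * shift (p ⋆ a) n
    ≡⟨ commute d c (a n) (shift (p ⋆ a) n) ⟩
  c * (d * a n + shift (p ⋆ a) n) ∎
  where commute : ∀ d c x z → d * (c * x) + c * z ≡ c * (d * x + z)
        commute = solve-∀

⋆-neg : ∀ p a n → (p ⋆ (λ m → - a m)) n ≡ - (p ⋆ a) n
⋆-neg p a n = begin
  (p ⋆ (λ m → - a m)) n          ≡⟨ ⋆-cong p (λ m → sym (ℤₚ.-1*i≡-i (a m))) n ⟩
  (p ⋆ (λ m → - (+ 1) * a m)) n  ≡⟨ ⋆-*ˡ p (- (+ 1)) a n ⟩
  - (+ 1) * (p ⋆ a) n            ≡⟨ ℤₚ.-1*i≡-i _ ⟩
  - (p ⋆ a) n                    ∎

⋆-sub : ∀ p a b n → (p ⋆ (λ m → a m - b m)) n ≡ (p ⋆ a) n - (p ⋆ b) n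
⋆-sub p a b n = trans (⋆-+ p a (λ m → - b m) n) (cong (_+_ ((p ⋆ a) n)) (⋆-neg p b n))

⋆-shift : ∀ p a n → (p ⋆ shift a) n ≡ shift (p ⋆ a) n
⋆-shift []      a zero    = refl
⋆-shift []      a (suc n) = refl
⋆-shift (c ∷ p) a zero    = cong (_+ + 0) (ℤₚ.*-zeroʳ c)
⋆-shift (c ∷ p) a (suc n) = cong (_+_ (c * a n)) (⋆-shift p a n)

⋆-⊕ : ∀ p q a n → ((p ⊕ q) ⋆ a) n ≡ (p ⋆ a) n + (q ⋆ a) n
⋆-⊕ []      q       a n = sym (ℤₚ.+-identityˡ _)
⋆-⊕ (c ∷ p) []      a n = sym (ℤₚ.+-identityʳ _)
⋆-⊕ (c ∷ p) (d ∷ q) a n = begin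
  (c + d) * a n + shift ((p ⊕ q) ⋆ a) n
    ≡⟨ cong (_+_ ((c + d) * a n)) (trans (shift-cong (⋆-⊕ p q a) n) (shift-+ (p ⋆ a) (q ⋆ a) n)) ⟩
  (c + d) * a n + (shift (p ⋆ a) n + shift (q ⋆ a) n)
    ≡⟨ distrib c d (a n) (shift (p ⋆ a) n) (shift (q ⋆ a) n) ⟩
  (c * a n + shift (p ⋆ a) n) + (d * a n + shift (q ⋆ a) n) ∎
  where distrib : ∀ c d x y z → (c + d) * x + (y + z) ≡ (c * x + y) + (d * x + z)
        distrib = solve-∀

⋆-scale : ∀ c p a n → (scale c p ⋆ a) n ≡ c * (p ⋆ a) n
⋆-scale c []      a n = sym (ℤₚ.*-zeroʳ c)
⋆-scale c (d ∷ p) a n = begin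
  (c * d) * a n + shift (scale c p ⋆ a) n
    ≡⟨ cong (_+_ ((c * d) * a n)) (trans (shift-cong (⋆-scale c p a) n) (shift-*ˡ c (p ⋆ a) n)) ⟩
  (c * d) * a n + c * shift (p ⋆ a) n
    ≡⟨ distrib c d (a n) (shift (p ⋆ a) n) ⟩
  c * (d * a n + shift (p ⋆ a) n) ∎
  where distrib : ∀ c d x y → (c * d) * x + c * y ≡ c * (d * x + y)
        distrib = solve-∀

⋆-⊗ : ∀ p q a n → ((p ⊗ q) ⋆ a) n ≡ (p ⋆ (q ⋆ a)) n
⋆-⊗ []      q a n = refl
⋆-⊗ (c ∷ p) q a n = begin
  ((scale c q ⊕ (+ 0 ∷ (p ⊗ q))) ⋆ a) n
    ≡⟨ ⋆-⊕ (scale c q) (+ 0 ∷ (p ⊗ q)) a n ⟩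
  (scale c q ⋆ a) n + (+ 0 * a n + shift ((p ⊗ q) ⋆ a) n)
    ≡⟨ cong₂ _+_ (⋆-scale c q a n) (cong (_+ shift ((p ⊗ q) ⋆ a) n) (ℤₚ.*-zeroˡ (a n))) ⟩
  c * (q ⋆ a) n + (+ 0 + shift ((p ⊗ q) ⋆ a) n)
    ≡⟨ cong (_+_ (c * (q ⋆ a) n)) (trans (ℤₚ.+-identityˡ _) (shift-cong (⋆-⊗ p q a) n)) ⟩
  c * (q ⋆ a) n + shift (p ⋆ (q ⋆ a)) n ∎

⋆-comm : ∀ p q a n → (p ⋆ (q ⋆ a)) n ≡ (q ⋆ (p ⋆ a)) n
⋆-comm []      q a n = sym (⋆-zero q (λ _ → refl) n)
⋆-comm (c ∷ p) q a n = sym (begin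
  (q ⋆ (λ m → c * a m + shift (p ⋆ a) m)) n
    ≡⟨ ⋆-+ q (λ m → c * a m) (shift (p ⋆ a)) n ⟩
  (q ⋆ (λ m → c * a m)) n + (q ⋆ shift (p ⋆ a)) n
    ≡⟨ cong₂ _+_ (⋆-*ˡ q c a n) (⋆-shift q (p ⋆ a) n) ⟩
  c * (q ⋆ a) n + shift (q ⋆ (p ⋆ a)) n
    ≡⟨ cong (_+_ (c * (q ⋆ a) n)) (shift-cong (λ m → sym (⋆-comm p q a m)) n) ⟩
  c * (q ⋆ a) n + shift (p ⋆ (q ⋆ a)) n ∎)

⋆-one : ∀ a n → (one ⋆ a) n ≡ a n
⋆-one a zero    = trans (ℤₚ.+-identityʳ _) (ℤₚ.*-identityˡ _)
⋆-one a (suc n) = trans (ℤₚ.+-identityʳ _) (ℤₚ.*-identityˡ _)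

⋆-^-+ : ∀ p i j a n → ((p ⊗^ (i +ℕ j)) ⋆ a) n ≡ ((p ⊗^ i) ⋆ ((p ⊗^ j) ⋆ a)) n
⋆-^-+ p zero    j a n = sym (⋆-one ((p ⊗^ j) ⋆ a) n)
⋆-^-+ p (suc i) j a n = begin
  ((p ⊗ (p ⊗^ (i +ℕ j))) ⋆ a) n          ≡⟨ ⋆-⊗ p (p ⊗^ (i +ℕ j)) a n ⟩
  (p ⋆ ((p ⊗^ (i +ℕ j)) ⋆ a)) n          ≡⟨ ⋆-cong p (⋆-^-+ p i j a) n ⟩
  (p ⋆ ((p ⊗^ i) ⋆ ((p ⊗^ j) ⋆ a))) n    ≡⟨ ⋆-⊗ p (p ⊗^ i) _ n ⟨
  ((p ⊗ (p ⊗^ i)) ⋆ ((p ⊗^ j) ⋆ a)) n    ∎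

coeff≗⋆δ : ∀ p → coeff p ≗ p ⋆ δ
coeff≗⋆δ []      n       = refl
coeff≗⋆δ (c ∷ p) zero    = sym (trans (ℤₚ.+-identityʳ _) (ℤₚ.*-identityʳ c))
coeff≗⋆δ (c ∷ p) (suc n) = sym (begin
  c * + 0 + (p ⋆ δ) n  ≡⟨ cong (_+ (p ⋆ δ) n) (ℤₚ.*-zeroʳ c) ⟩
  + 0 + (p ⋆ δ) n      ≡⟨ ℤₚ.+-identityˡ _ ⟩
  (p ⋆ δ) n            ≡⟨ coeff≗⋆δ p n ⟨
  coeff p n            ∎)

⋆-constant : ∀ c b n → ((c ∷ []) ⋆ b) n ≡ c * b n
⋆-constant c b zero    = ℤₚ.+-identityʳ _
⋆-constant c b (suc n) = ℤₚ.+-identityʳ _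

⋆-linear : ∀ c d b n → ((c ∷ d ∷ []) ⋆ b) n ≡ c * b n + d * shift b n
⋆-linear c d b zero    = cong (_+_ (c * b 0)) (sym (ℤₚ.*-zeroʳ d))
⋆-linear c d b (suc n) = cong (_+_ (c * b (suc n))) (⋆-constant d b n)

X⋆ : ∀ b n → (X ⋆ b) n ≡ shift b n
X⋆ b n = trans (⋆-linear (+ 0) (+ 1) b n) (simplify (b n) (shift b n))
  where simplify : ∀ x y → + 0 * x + + 1 * y ≡ y
        simplify = solve-∀

X-1⋆ : ∀ b n → (X-1 ⋆ b) n ≡ shift b n - b n
X-1⋆ b n = trans (⋆-linear (- (+ 1)) (+ 1) b n) (simplify (b n) (shift b n))
  where simplify : ∀ x y → - (+ 1) * x + + 1 * y ≡ y - x
        simplify = solve-∀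

2X-1⋆ : ∀ b n → (2X-1 ⋆ b) n ≡ + 2 * shift b n - b n
2X-1⋆ b n = trans (⋆-linear (- (+ 1)) (+ 2) b n) (simplify (b n) (shift b n))
  where simplify : ∀ x y → - (+ 1) * x + + 2 * y ≡ + 2 * y - x
        simplify = solve-∀

negX⋆ : ∀ b n → (neg X ⋆ b) n ≡ - shift b n
negX⋆ b n = trans (⋆-linear (- (+ 1) * + 0) (- (+ 1) * + 1) b n) (simplify (b n) (shift b n))
  where simplify : ∀ x y → - (+ 1) * + 0 * x + - (+ 1) * + 1 * y ≡ - y
        simplify = solve-∀

sign : ℕ → ℤ
sign n = (- (+ 1)) ^ℤ n

negX^⋆ : ∀ i b n → ((neg X ⊗^ i) ⋆ b) n ≡ sign i * ((X ⊗^ i) ⋆ b) n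
negX^⋆ zero    b n = sym (ℤₚ.*-identityˡ _)
negX^⋆ (suc i) b n = begin
  ((neg X ⊗ (neg X ⊗^ i)) ⋆ b) n                    ≡⟨ ⋆-⊗ (neg X) (neg X ⊗^ i) b n ⟩
  (neg X ⋆ ((neg X ⊗^ i) ⋆ b)) n                    ≡⟨ negX⋆ _ n ⟩
  - shift ((neg X ⊗^ i) ⋆ b) n                       ≡⟨ cong -_ (shift-cong (negX^⋆ i b) n) ⟩
  - shift (λ m → sign i * ((X ⊗^ i) ⋆ b) m) n        ≡⟨ cong -_ (shift-*ˡ (sign i) _ n) ⟩
  - (sign i * shift ((X ⊗^ i) ⋆ b) n)                ≡⟨ regroup (sign i) _ ⟩
  (- (+ 1) * sign i) * shift ((X ⊗^ i) ⋆ b) n        ≡⟨ cong (_*_ (sign (suc i))) (X⋆ _ n) ⟨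
  sign (suc i) * (X ⋆ ((X ⊗^ i) ⋆ b)) n              ≡⟨ cong (_*_ (sign (suc i))) (⋆-⊗ X (X ⊗^ i) b n) ⟨
  sign (suc i) * ((X ⊗ (X ⊗^ i)) ⋆ b) n              ∎
  where regroup : ∀ a b → - (a * b) ≡ (- (+ 1) * a) * b
        regroup = solve-∀

binomialTransform : Series → Series
binomialTransform s n = sumTo n (λ j → + (n C j) * s j)

binomialTransform-cong : ∀ {s t} → s ≗ t → binomialTransform s ≗ binomialTransform t
binomialTransform-cong s≗t n = sumTo-cong n (λ j → cong (+ (n C j) *_) (s≗t j))

binomialTransform-neg : ∀ s n → binomialTransform (λ j → - s j) n ≡ - binomialTransform s n
binomialTransform-neg s n =
  trans (sumTo-cong n (λ j → sym (ℤₚ.neg-distribʳ-* (+ (n C j)) (s j)))) (sumTo-neg n _)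

binomialTransform-suc : ∀ s n →
  binomialTransform s (suc n) ≡ binomialTransform s n + binomialTransform (drop 1 s) n
binomialTransform-suc s n = begin
  binomialTransform s (suc n)
    ≡⟨ sumTo-suc n _ ⟩
  s₀ + sumTo n (λ j → + (suc n C suc j) * s (suc j))
    ≡⟨ cong (_+_ s₀) (sumTo-cong n pascal) ⟩
  s₀ + sumTo n (λ j → + (n C j) * s (suc j) + + (n C suc j) * s (suc j))
    ≡⟨ cong (_+_ s₀) (sumTo-+ n _ _) ⟩
  s₀ + (binomialTransform (drop 1 s) n + rest)
    ≡⟨ reorder s₀ (binomialTransform (drop 1 s) n) rest ⟩
  (s₀ + rest) + binomialTransform (drop 1 s) n
    ≡⟨ cong (_+ binomialTransform (drop 1 s) n) head+rest ⟨
  binomialTransform s n + binomialTransform (drop 1 s) n ∎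
  where
  s₀ = + 1 * s 0
  rest = sumTo n (λ j → + (n C suc j) * s (suc j))
  pascal : ∀ j → + (suc n C suc j) * s (suc j) ≡ + (n C j) * s (suc j) + + (n C suc j) * s (suc j)
  pascal j = trans (cong (λ c → + c * s (suc j)) (sym (nCk+nC[k+1]≡[n+1]C[k+1] n j)))
                   (ℤₚ.*-distribʳ-+ (s (suc j)) (+ (n C j)) (+ (n C suc j)))
  reorder : ∀ a b c → a + (b + c) ≡ (a + c) + b
  reorder = solve-∀
  head+rest : binomialTransform s n ≡ s₀ + rest
  head+rest = begin
    binomialTransform s n
      ≡⟨ ℤₚ.+-identityʳ _ ⟨
    binomialTransform s n + + 0
      ≡⟨ cong (_+_ (binomialTransform s n)) (trans (cong (λ c → + c * s (suc n)) (k>n⇒nCk≡0 (ℕₚ.n<1+n n)))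
                                                (ℤₚ.*-zeroˡ (s (suc n)))) ⟨
    sumTo (suc n) (λ j → + (n C j) * s j)
      ≡⟨ sumTo-suc n _ ⟩
    s₀ + rest ∎

-- In generating functions: (1 - x) G_s(x) = s₀ + x G_{drop 1 s}(x).
X-1⋆binomialTransform : ∀ s n →
  (X-1 ⋆ binomialTransform s) n ≡ - shift (binomialTransform (drop 1 s)) n - s 0 * δ n
X-1⋆binomialTransform s zero = trans (X-1⋆ (binomialTransform s) 0) (simplify (s 0))
  where simplify : ∀ x → + 0 - + 1 * x ≡ - + 0 - x * + 1
        simplify = solve-∀
X-1⋆binomialTransform s (suc n) = begin
  (X-1 ⋆ binomialTransform s) (suc n)
    ≡⟨ X-1⋆ (binomialTransform s) (suc n) ⟩
  binomialTransform s n - binomialTransform s (suc n)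
    ≡⟨ cong (_-_ (binomialTransform s n)) (binomialTransform-suc s n) ⟩
  binomialTransform s n - (binomialTransform s n + binomialTransform (drop 1 s) n)
    ≡⟨ simplify (binomialTransform s n) (binomialTransform (drop 1 s) n) (s 0) ⟩
  - binomialTransform (drop 1 s) n - s 0 * + 0 ∎
  where simplify : ∀ x y z → x - (x + y) ≡ - y - z * + 0
        simplify = solve-∀

-- With G_s the generating function of binomialTransform s, headPart i s is
-- (x - 1)ⁱ G_s - (-x)ⁱ G_{drop i s}, which only depends on s₀, …, s_{i-1}.
headPart : ℕ → Series → Series
headPart i s n =
  ((X-1 ⊗^ i) ⋆ binomialTransform s) n - ((neg X ⊗^ i) ⋆ binomialTransform (drop i s)) n

headPart-suc : ∀ i s → s 0 ≡ + 1 → ∀ n →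
  headPart (suc i) s n ≡ - shift (headPart i (drop 1 s)) n - ((X-1 ⊗^ i) ⋆ δ) n
headPart-suc i s s₀≡1 n = begin
  headPart (suc i) s n
    ≡⟨ cong₂ _-_ (⋆-⊗ X-1 (X-1 ⊗^ i) (B s) n) (⋆-⊗ (neg X) (neg X ⊗^ i) (B s′) n) ⟩
  (X-1 ⋆ ((X-1 ⊗^ i) ⋆ B s)) n - (neg X ⋆ A₂) n
    ≡⟨ cong₂ _-_ (⋆-comm X-1 (X-1 ⊗^ i) (B s) n) (negX⋆ A₂ n) ⟩
  ((X-1 ⊗^ i) ⋆ (X-1 ⋆ B s)) n - - shift A₂ n
    ≡⟨ cong (_- - shift A₂ n) (⋆-cong (X-1 ⊗^ i) X-1⋆Bs n) ⟩
  ((X-1 ⊗^ i) ⋆ (λ m → - shift (B (drop 1 s)) m - δ m)) n - - shift A₂ n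
    ≡⟨ cong (_- - shift A₂ n) (⋆-sub (X-1 ⊗^ i) (λ m → - shift (B (drop 1 s)) m) δ n) ⟩
  (((X-1 ⊗^ i) ⋆ (λ m → - shift (B (drop 1 s)) m)) n - y n) - - shift A₂ n
    ≡⟨ cong (λ z → (z - y n) - - shift A₂ n) (⋆-neg (X-1 ⊗^ i) (shift (B (drop 1 s))) n) ⟩
  (- ((X-1 ⊗^ i) ⋆ shift (B (drop 1 s))) n - y n) - - shift A₂ n
    ≡⟨ cong (λ z → (- z - y n) - - shift A₂ n) (⋆-shift (X-1 ⊗^ i) (B (drop 1 s)) n) ⟩
  (- shift A₁ n - y n) - - shift A₂ n
    ≡⟨ regroup (shift A₁ n) (shift A₂ n) (y n) ⟩
  - (shift A₁ n - shift A₂ n) - y n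
    ≡⟨ cong (λ z → - z - y n) (shift-sub A₁ A₂ n) ⟨
  - shift (headPart i (drop 1 s)) n - y n ∎
  where
  B = binomialTransform
  s′ = drop (suc i) s
  A₁ = (X-1 ⊗^ i) ⋆ B (drop 1 s)
  A₂ = (neg X ⊗^ i) ⋆ B s′
  y = (X-1 ⊗^ i) ⋆ δ
  X-1⋆Bs : ∀ m → (X-1 ⋆ B s) m ≡ - shift (B (drop 1 s)) m - δ m
  X-1⋆Bs m = begin
    (X-1 ⋆ B s) m                           ≡⟨ X-1⋆binomialTransform s m ⟩
    - shift (B (drop 1 s)) m - s 0 * δ m    ≡⟨ cong (λ c → - shift (B (drop 1 s)) m - c * δ m) s₀≡1 ⟩
    - shift (B (drop 1 s)) m - + 1 * δ m    ≡⟨ cong (_-_ (- shift (B (drop 1 s)) m)) (ℤₚ.*-identityˡ (δ m)) ⟩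
    - shift (B (drop 1 s)) m - δ m          ∎
  regroup : ∀ a b c → (- a - c) - - b ≡ - (a - b) - c
  regroup = solve-∀

-- Since 2x - 1 = (x - 1) - (-x), multiplying by it telescopes the geometric sum of the leading ones.
2X-1⋆headPart : ∀ i s → (∀ t → t < i → s t ≡ + 1) → ∀ n →
  (2X-1 ⋆ headPart i s) n ≡ ((neg X ⊗^ i) ⋆ δ) n - ((X-1 ⊗^ i) ⋆ δ) n
2X-1⋆headPart zero s _ n = begin
  (2X-1 ⋆ headPart 0 s) n         ≡⟨ ⋆-zero 2X-1 vanish n ⟩
  + 0                             ≡⟨ ℤₚ.+-inverseʳ ((one ⋆ δ) n) ⟨
  (one ⋆ δ) n - (one ⋆ δ) n       ∎
  where vanish : ∀ m → headPart 0 s m ≡ + 0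
        vanish m = trans (cong₂ _-_ (⋆-one (binomialTransform s) m) (⋆-one (binomialTransform s) m))
                         (ℤₚ.+-inverseʳ (binomialTransform s m))
2X-1⋆headPart (suc i) s ones n = begin
  (2X-1 ⋆ headPart (suc i) s) n
    ≡⟨ ⋆-cong 2X-1 (headPart-suc i s (ones 0 (s≤s z≤n))) n ⟩
  (2X-1 ⋆ (λ m → - shift w m - y m)) n
    ≡⟨ ⋆-sub 2X-1 (λ m → - shift w m) y n ⟩
  (2X-1 ⋆ (λ m → - shift w m)) n - (2X-1 ⋆ y) n
    ≡⟨ cong₂ _-_ (trans (⋆-neg 2X-1 (shift w) n) (cong -_ (⋆-shift 2X-1 w n))) (2X-1⋆ y n) ⟩
  - shift (2X-1 ⋆ w) n - (+ 2 * shift y n - y n)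
    ≡⟨ cong (λ z → - z - (+ 2 * shift y n - y n))
            (trans (shift-cong (2X-1⋆headPart i (drop 1 s) (λ t t<i → ones (suc t) (s≤s t<i))) n)
                   (shift-sub z y n)) ⟩
  - (shift z n - shift y n) - (+ 2 * shift y n - y n)
    ≡⟨ regroup (shift z n) (shift y n) (y n) ⟩
  - shift z n - (shift y n - y n)
    ≡⟨ cong₂ _-_ (negX⋆ z n) (X-1⋆ y n) ⟨
  (neg X ⋆ z) n - (X-1 ⋆ y) n
    ≡⟨ cong₂ _-_ (⋆-⊗ (neg X) (neg X ⊗^ i) δ n) (⋆-⊗ X-1 (X-1 ⊗^ i) δ n) ⟨
  ((neg X ⊗^ suc i) ⋆ δ) n - ((X-1 ⊗^ suc i) ⋆ δ) n ∎
  where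
  w = headPart i (drop 1 s)
  y = (X-1 ⊗^ i) ⋆ δ
  z = (neg X ⊗^ i) ⋆ δ
  regroup : ∀ a b c → - (a - b) - (+ 2 * b - c) ≡ - a - (b - c)
  regroup = solve-∀

sign-+ : ∀ a b → sign (a +ℕ b) ≡ sign a * sign b
sign-+ = ℤₚ.^-distribˡ-+-* (- (+ 1))

sign*sign≡1 : ∀ n → sign n * sign n ≡ + 1
sign*sign≡1 zero    = refl
sign*sign≡1 (suc n) = trans (square (sign n)) (sign*sign≡1 n)
  where square : ∀ x → (- (+ 1) * x) * (- (+ 1) * x) ≡ x * x
        square = solve-∀

sign-2^suc : ∀ k → sign (2 ^ suc k) ≡ + 1
sign-2^suc k = trans (sym (ℤₚ.^-*-assoc (- (+ 1)) 2 (2 ^ k))) (ℤₚ.^-zeroˡ (2 ^ k))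

-- Coefficientwise form of (1 + x)ᵐ ≡ 1 + xᵐ (mod 2): C(j + m, t) ≡ C(j, t) + C(j, t - m).
record FrobeniusMod2 (m : ℕ) : Set where
  field
    high : ∀ j t → sign ((j +ℕ m) C (t +ℕ m)) ≡ sign (j C (t +ℕ m)) * sign (j C t)
    low  : ∀ j t → t < m → sign ((j +ℕ m) C t) ≡ sign (j C t)

frobeniusMod2-1 : FrobeniusMod2 1
frobeniusMod2-1 = record { high = high ; low = low }
  where
  high : ∀ j t → sign ((j +ℕ 1) C (t +ℕ 1)) ≡ sign (j C (t +ℕ 1)) * sign (j C t)
  high j t = begin
    sign ((j +ℕ 1) C (t +ℕ 1))      ≡⟨ cong₂ (λ a b → sign (a C b)) (ℕₚ.+-comm j 1) (ℕₚ.+-comm t 1) ⟩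
    sign (suc j C suc t)            ≡⟨ cong sign (nCk+nC[k+1]≡[n+1]C[k+1] j t) ⟨
    sign (j C t +ℕ j C suc t)       ≡⟨ sign-+ (j C t) (j C suc t) ⟩
    sign (j C t) * sign (j C suc t) ≡⟨ ℤₚ.*-comm (sign (j C t)) (sign (j C suc t)) ⟩
    sign (j C suc t) * sign (j C t) ≡⟨ cong (λ u → sign (j C u) * sign (j C t)) (ℕₚ.+-comm 1 t) ⟩
    sign (j C (t +ℕ 1)) * sign (j C t) ∎
  low : ∀ j t → t < 1 → sign ((j +ℕ 1) C t) ≡ sign (j C t)
  low j zero (s≤s z≤n) = refl

frobeniusMod2-double : ∀ {m} → FrobeniusMod2 m → FrobeniusMod2 (m +ℕ m)
frobeniusMod2-double {m} frob = record { high = high ; low = low }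
  where
  open FrobeniusMod2 frob renaming (high to high₁; low to low₁)
  cancel : ∀ a b c → b * b ≡ + 1 → (a * b) * (b * c) ≡ a * c
  cancel a b c b²≡1 = trans (regroup a b c) (trans (cong (λ z → a * z * c) b²≡1) (unit a c))
    where regroup : ∀ a b c → (a * b) * (b * c) ≡ a * (b * b) * c
          regroup = solve-∀
          unit : ∀ a c → a * + 1 * c ≡ a * c
          unit = solve-∀
  high : ∀ j t → sign ((j +ℕ (m +ℕ m)) C (t +ℕ (m +ℕ m))) ≡ sign (j C (t +ℕ (m +ℕ m))) * sign (j C t)
  high j t = begin
    sign ((j +ℕ (m +ℕ m)) C (t +ℕ (m +ℕ m)))
      ≡⟨ cong₂ (λ a b → sign (a C b)) (ℕₚ.+-assoc j m m) (ℕₚ.+-assoc t m m) ⟨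
    sign (((j +ℕ m) +ℕ m) C ((t +ℕ m) +ℕ m))
      ≡⟨ high₁ (j +ℕ m) (t +ℕ m) ⟩
    sign ((j +ℕ m) C ((t +ℕ m) +ℕ m)) * sign ((j +ℕ m) C (t +ℕ m))
      ≡⟨ cong₂ _*_ (high₁ j (t +ℕ m)) (high₁ j t) ⟩
    (sign (j C ((t +ℕ m) +ℕ m)) * sign (j C (t +ℕ m))) * (sign (j C (t +ℕ m)) * sign (j C t))
      ≡⟨ cancel (sign (j C ((t +ℕ m) +ℕ m))) (sign (j C (t +ℕ m))) (sign (j C t))
                (sign*sign≡1 (j C (t +ℕ m))) ⟩
    sign (j C ((t +ℕ m) +ℕ m)) * sign (j C t)
      ≡⟨ cong (λ u → sign (j C u) * sign (j C t)) (ℕₚ.+-assoc t m m) ⟩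
    sign (j C (t +ℕ (m +ℕ m))) * sign (j C t) ∎
  lowShifted : ∀ j u → u < m → sign ((j +ℕ (m +ℕ m)) C (u +ℕ m)) ≡ sign (j C (u +ℕ m))
  lowShifted j u u<m = begin
    sign ((j +ℕ (m +ℕ m)) C (u +ℕ m))
      ≡⟨ cong (λ a → sign (a C (u +ℕ m))) (ℕₚ.+-assoc j m m) ⟨
    sign (((j +ℕ m) +ℕ m) C (u +ℕ m))
      ≡⟨ high₁ (j +ℕ m) u ⟩
    sign ((j +ℕ m) C (u +ℕ m)) * sign ((j +ℕ m) C u)
      ≡⟨ cong₂ _*_ (high₁ j u) (low₁ j u u<m) ⟩
    (sign (j C (u +ℕ m)) * sign (j C u)) * sign (j C u)
      ≡⟨ ℤₚ.*-assoc (sign (j C (u +ℕ m))) _ _ ⟩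
    sign (j C (u +ℕ m)) * (sign (j C u) * sign (j C u))
      ≡⟨ cong (_*_ (sign (j C (u +ℕ m)))) (sign*sign≡1 (j C u)) ⟩
    sign (j C (u +ℕ m)) * + 1
      ≡⟨ ℤₚ.*-identityʳ _ ⟩
    sign (j C (u +ℕ m)) ∎
  low : ∀ j t → t < m +ℕ m → sign ((j +ℕ (m +ℕ m)) C t) ≡ sign (j C t)
  low j t t<2m with t ℕₚ.<? m
  ... | yes t<m = trans (cong (λ a → sign (a C t)) (sym (ℕₚ.+-assoc j m m)))
                        (trans (low₁ (j +ℕ m) t t<m) (low₁ j t t<m))
  ... | no t≮m = subst (λ v → sign ((j +ℕ (m +ℕ m)) C v) ≡ sign (j C v)) u+m≡t (lowShifted j (t ∸ m) u<m)
    where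
    u+m≡t : (t ∸ m) +ℕ m ≡ t
    u+m≡t = ℕₚ.m∸n+n≡m (ℕₚ.≮⇒≥ t≮m)
    u<m : t ∸ m < m
    u<m = ℕₚ.+-cancelʳ-< m (t ∸ m) m (subst (_< m +ℕ m) (sym u+m≡t) t<2m)

frobeniusMod2-2^ : ∀ k → FrobeniusMod2 (2 ^ k)
frobeniusMod2-2^ zero    = frobeniusMod2-1
frobeniusMod2-2^ (suc k) =
  subst FrobeniusMod2 (cong (2 ^ k +ℕ_) (sym (ℕₚ.+-identityʳ (2 ^ k))))
        (frobeniusMod2-double (frobeniusMod2-2^ k))

sign-C-2^-antiperiodic : ∀ k j → sign ((2 ^ k +ℕ j) C (2 ^ k)) ≡ - sign (j C (2 ^ k))
sign-C-2^-antiperiodic k j = begin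
  sign ((2 ^ k +ℕ j) C (2 ^ k))            ≡⟨ cong (λ a → sign (a C (2 ^ k))) (ℕₚ.+-comm (2 ^ k) j) ⟩
  sign ((j +ℕ 2 ^ k) C (0 +ℕ 2 ^ k))       ≡⟨ FrobeniusMod2.high (frobeniusMod2-2^ k) j 0 ⟩
  sign (j C (2 ^ k)) * - (+ 1)             ≡⟨ ℤₚ.*-comm _ (- (+ 1)) ⟩
  - (+ 1) * sign (j C (2 ^ k))             ≡⟨ ℤₚ.-1*i≡-i _ ⟩
  - sign (j C (2 ^ k))                     ∎

plusTerm⋆ : ∀ j a n → (plusTerm j ⋆ a) n ≡ ((X ⊗^ (2 ^ j)) ⋆ a) n + ((X-1 ⊗^ (2 ^ j)) ⋆ a) n
plusTerm⋆ j = ⋆-⊕ (X ⊗^ (2 ^ j)) (X-1 ⊗^ (2 ^ j))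

minusTerm⋆ : ∀ j a n → (minusTerm j ⋆ a) n ≡ ((X ⊗^ (2 ^ j)) ⋆ a) n - ((X-1 ⊗^ (2 ^ j)) ⋆ a) n
minusTerm⋆ j a n = trans (⋆-⊕ (X ⊗^ (2 ^ j)) (neg (X-1 ⊗^ (2 ^ j))) a n)
  (cong (_+_ (((X ⊗^ (2 ^ j)) ⋆ a) n)) (trans (⋆-scale (- (+ 1)) (X-1 ⊗^ (2 ^ j)) a n) (ℤₚ.-1*i≡-i _)))

⋆-^-2^suc : ∀ p j a n → ((p ⊗^ (2 ^ suc j)) ⋆ a) n ≡ ((p ⊗^ (2 ^ j)) ⋆ ((p ⊗^ (2 ^ j)) ⋆ a)) n
⋆-^-2^suc p j a n = trans (⋆-^-+ p (2 ^ j) (2 ^ j +ℕ 0) a n)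
  (⋆-cong (p ⊗^ (2 ^ j)) (λ m → cong (λ e → ((p ⊗^ e) ⋆ a) m) (ℕₚ.+-identityʳ (2 ^ j))) n)

plusTerm⋆minusTerm : ∀ j a n → (plusTerm j ⋆ (minusTerm j ⋆ a)) n ≡ (minusTerm (suc j) ⋆ a) n
plusTerm⋆minusTerm j a n = begin
  (plusTerm j ⋆ (minusTerm j ⋆ a)) n
    ≡⟨ plusTerm⋆ j (minusTerm j ⋆ a) n ⟩
  (A ⋆ (minusTerm j ⋆ a)) n + (B ⋆ (minusTerm j ⋆ a)) n
    ≡⟨ cong₂ _+_ (expand A) (expand B) ⟩
  ((A ⋆ (A ⋆ a)) n - (A ⋆ (B ⋆ a)) n) + ((B ⋆ (A ⋆ a)) n - (B ⋆ (B ⋆ a)) n)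
    ≡⟨ cong (λ z → ((A ⋆ (A ⋆ a)) n - (A ⋆ (B ⋆ a)) n) + (z - (B ⋆ (B ⋆ a)) n)) (⋆-comm B A a n) ⟩
  ((A ⋆ (A ⋆ a)) n - (A ⋆ (B ⋆ a)) n) + ((A ⋆ (B ⋆ a)) n - (B ⋆ (B ⋆ a)) n)
    ≡⟨ telescope ((A ⋆ (A ⋆ a)) n) ((A ⋆ (B ⋆ a)) n) ((B ⋆ (B ⋆ a)) n) ⟩
  (A ⋆ (A ⋆ a)) n - (B ⋆ (B ⋆ a)) n
    ≡⟨ cong₂ _-_ (⋆-^-2^suc X j a n) (⋆-^-2^suc X-1 j a n) ⟨
  ((X ⊗^ (2 ^ suc j)) ⋆ a) n - ((X-1 ⊗^ (2 ^ suc j)) ⋆ a) n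
    ≡⟨ minusTerm⋆ (suc j) a n ⟨
  (minusTerm (suc j) ⋆ a) n ∎
  where
  A = X ⊗^ (2 ^ j)
  B = X-1 ⊗^ (2 ^ j)
  expand : ∀ p → (p ⋆ (minusTerm j ⋆ a)) n ≡ (p ⋆ (A ⋆ a)) n - (p ⋆ (B ⋆ a)) n
  expand p = trans (⋆-cong p (minusTerm⋆ j a) n) (⋆-sub p (A ⋆ a) (B ⋆ a) n)
  telescope : ∀ x y z → (x - y) + (y - z) ≡ x - z
  telescope = solve-∀

2X-1≗minusTerm1 : coeff 2X-1 ≗ coeff (minusTerm 1)
2X-1≗minusTerm1 zero                = refl
2X-1≗minusTerm1 (suc zero)          = refl
2X-1≗minusTerm1 (suc (suc zero))    = refl
2X-1≗minusTerm1 (suc (suc (suc n))) = refl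

2X-1⋆prodFrom1Below : ∀ k n → (2X-1 ⋆ (prodFrom1Below (suc k) ⋆ δ)) n ≡ (minusTerm (suc k) ⋆ δ) n
2X-1⋆prodFrom1Below zero n = begin
  (2X-1 ⋆ (one ⋆ δ)) n     ≡⟨ ⋆-cong 2X-1 (⋆-one δ) n ⟩
  (2X-1 ⋆ δ) n             ≡⟨ coeff≗⋆δ 2X-1 n ⟨
  coeff 2X-1 n             ≡⟨ 2X-1≗minusTerm1 n ⟩
  coeff (minusTerm 1) n    ≡⟨ coeff≗⋆δ (minusTerm 1) n ⟩
  (minusTerm 1 ⋆ δ) n      ∎
2X-1⋆prodFrom1Below (suc k) n = begin
  (2X-1 ⋆ ((P ⊗ T) ⋆ δ)) n               ≡⟨ ⋆-cong 2X-1 (⋆-⊗ P T δ) n ⟩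
  (2X-1 ⋆ (P ⋆ (T ⋆ δ))) n               ≡⟨ ⋆-cong 2X-1 (⋆-comm P T δ) n ⟩
  (2X-1 ⋆ (T ⋆ (P ⋆ δ))) n               ≡⟨ ⋆-comm 2X-1 T (P ⋆ δ) n ⟩
  (T ⋆ (2X-1 ⋆ (P ⋆ δ))) n               ≡⟨ ⋆-cong T (2X-1⋆prodFrom1Below k) n ⟩
  (T ⋆ (minusTerm (suc k) ⋆ δ)) n        ≡⟨ plusTerm⋆minusTerm (suc k) δ n ⟩
  (minusTerm (suc (suc k)) ⋆ δ) n        ∎
  where
  P = prodFrom1Below (suc k)
  T = plusTerm (suc k)

-- The constant coefficient of 2x - 1 is a unit, so (2X-1 ⋆ a) n determines a n from a (n - 1).
2X-1⋆-injective : ∀ {a b} → 2X-1 ⋆ a ≗ 2X-1 ⋆ b → a ≗ b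
2X-1⋆-injective {a} {b} eq n = ℤₚ.neg-injective (∙-cancelˡ (+ 2 * shift a n) (- a n) (- b n) (begin
  + 2 * shift a n - a n   ≡⟨ 2X-1⋆ a n ⟨
  (2X-1 ⋆ a) n            ≡⟨ eq n ⟩
  (2X-1 ⋆ b) n            ≡⟨ 2X-1⋆ b n ⟩
  + 2 * shift b n - b n   ≡⟨ cong (λ z → + 2 * z - b n) (shifts n) ⟨
  + 2 * shift a n - b n   ∎))
  where
  shifts : ∀ n → shift a n ≡ shift b n
  shifts zero    = refl
  shifts (suc n) = 2X-1⋆-injective {a} {b} eq n

negX^2^suc⋆ : ∀ k b n → ((neg X ⊗^ (2 ^ suc k)) ⋆ b) n ≡ ((X ⊗^ (2 ^ suc k)) ⋆ b) n
negX^2^suc⋆ k b n = begin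
  ((neg X ⊗^ (2 ^ suc k)) ⋆ b) n                       ≡⟨ negX^⋆ (2 ^ suc k) b n ⟩
  sign (2 ^ suc k) * ((X ⊗^ (2 ^ suc k)) ⋆ b) n        ≡⟨ cong (_* ((X ⊗^ (2 ^ suc k)) ⋆ b) n) (sign-2^suc k) ⟩
  + 1 * ((X ⊗^ (2 ^ suc k)) ⋆ b) n                     ≡⟨ ℤₚ.*-identityˡ _ ⟩
  ((X ⊗^ (2 ^ suc k)) ⋆ b) n                           ∎

module _ (k : ℕ) where

  private
    m : ℕ
    m = 2 ^ suc k

    s : Series
    s j = sign (j C m)

  headPart≗plusTerm⋆f : ∀ n → headPart m s n ≡ (plusTerm (suc k) ⋆ f m) n
  headPart≗plusTerm⋆f n = begin
    ((X-1 ⊗^ m) ⋆ f m) n - ((neg X ⊗^ m) ⋆ binomialTransform (drop m s)) n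
      ≡⟨ cong (_-_ (((X-1 ⊗^ m) ⋆ f m) n)) (negX^2^suc⋆ k _ n) ⟩
    ((X-1 ⊗^ m) ⋆ f m) n - ((X ⊗^ m) ⋆ binomialTransform (drop m s)) n
      ≡⟨ cong (_-_ (((X-1 ⊗^ m) ⋆ f m) n)) (⋆-cong (X ⊗^ m) tail≗-f n) ⟩
    ((X-1 ⊗^ m) ⋆ f m) n - ((X ⊗^ m) ⋆ (λ j → - f m j)) n
      ≡⟨ cong (_-_ (((X-1 ⊗^ m) ⋆ f m) n)) (⋆-neg (X ⊗^ m) (f m) n) ⟩
    ((X-1 ⊗^ m) ⋆ f m) n - - ((X ⊗^ m) ⋆ f m) n
      ≡⟨ swap (((X-1 ⊗^ m) ⋆ f m) n) (((X ⊗^ m) ⋆ f m) n) ⟩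
    ((X ⊗^ m) ⋆ f m) n + ((X-1 ⊗^ m) ⋆ f m) n
      ≡⟨ plusTerm⋆ (suc k) (f m) n ⟨
    (plusTerm (suc k) ⋆ f m) n ∎
    where
    tail≗-f : binomialTransform (drop m s) ≗ (λ j → - f m j)
    tail≗-f j = trans (binomialTransform-cong (sign-C-2^-antiperiodic (suc k)) j)
                      (binomialTransform-neg s j)
    swap : ∀ u v → u - - v ≡ v + u
    swap = solve-∀

  2X-1⋆plusTerm⋆f : ∀ n → (2X-1 ⋆ (plusTerm (suc k) ⋆ f m)) n ≡ (minusTerm (suc k) ⋆ δ) n
  2X-1⋆plusTerm⋆f n = begin
    (2X-1 ⋆ (plusTerm (suc k) ⋆ f m)) n               ≡⟨ ⋆-cong 2X-1 headPart≗plusTerm⋆f n ⟨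
    (2X-1 ⋆ headPart m s) n                           ≡⟨ 2X-1⋆headPart m s (λ t t<m → cong sign (k>n⇒nCk≡0 t<m)) n ⟩
    ((neg X ⊗^ m) ⋆ δ) n - ((X-1 ⊗^ m) ⋆ δ) n         ≡⟨ cong (_- ((X-1 ⊗^ m) ⋆ δ) n) (negX^2^suc⋆ k δ n) ⟩
    ((X ⊗^ m) ⋆ δ) n - ((X-1 ⊗^ m) ⋆ δ) n             ≡⟨ minusTerm⋆ (suc k) δ n ⟨
    (minusTerm (suc k) ⋆ δ) n                         ∎

proposition5p1 : (k : ℕ) → k ≥ 1 →
    ((n : ℕ) → mulSeries (plusTerm k) (f (2 ^ k)) n ≡ coeff (prodFrom1Below k) n)
    × ((n : ℕ) → mulSeries (2X-1 ⊗ plusTerm k) (f (2 ^ k)) n ≡ coeff (minusTerm k) n)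
proposition5p1 (suc k) _ = quotient , product
  where
  F = f (2 ^ suc k)
  Q = plusTerm (suc k)
  P = prodFrom1Below (suc k)
  product : ∀ n → mulSeries (2X-1 ⊗ Q) F n ≡ coeff (minusTerm (suc k)) n
  product n = begin
    mulSeries (2X-1 ⊗ Q) F n       ≡⟨ mulSeries≗⋆ (2X-1 ⊗ Q) F n ⟩
    ((2X-1 ⊗ Q) ⋆ F) n             ≡⟨ ⋆-⊗ 2X-1 Q F n ⟩
    (2X-1 ⋆ (Q ⋆ F)) n             ≡⟨ 2X-1⋆plusTerm⋆f k n ⟩
    (minusTerm (suc k) ⋆ δ) n      ≡⟨ coeff≗⋆δ (minusTerm (suc k)) n ⟨
    coeff (minusTerm (suc k)) n    ∎
  quotient : ∀ n → mulSeries Q F n ≡ coeff P n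
  quotient n = trans (mulSeries≗⋆ Q F n) (2X-1⋆-injective {Q ⋆ F} {coeff P} (λ i → begin
    (2X-1 ⋆ (Q ⋆ F)) i             ≡⟨ 2X-1⋆plusTerm⋆f k i ⟩
    (minusTerm (suc k) ⋆ δ) i      ≡⟨ 2X-1⋆prodFrom1Below k i ⟨
    (2X-1 ⋆ (P ⋆ δ)) i             ≡⟨ ⋆-cong 2X-1 (coeff≗⋆δ P) i ⟨
    (2X-1 ⋆ coeff P) i             ∎) n)
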